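{- Let $f$ be as defined in the context. Then $f(n-1,a)=f(n,a)$ for all $n,a\in\mathbb{N}^+$ with $n>a$.
   Context: A family $\mathcal{F}$ on ground set $[n]=\{1,\dots,n\}$ is a collection $\mathcal{S}(\mathcal{F})$ of distinct subsets of $[n]$ (elements of $[n]$ may lie in no set); $m(\mathcal{F})=|\mathcal{S}(\mathcal{F})|$. It is union-closed if $S\cup T\in\mathcal{S}(\mathcal{F})$ whenever $S,T\in\mathcal{S}(\mathcal{F})$. For $e\in[n]$, $m_e(\mathcal{F})$ is the number of sets of $\mathcal{F}$ containing $e$, and $a(\mathcal{F})=\max_{e\in[n]}m_e(\mathcal{F})$. For $n,a\in\mathbb{N}^+$, $f(n,a)$ is the maximum of $m(\mathcal{F})$ over all union-closed families $\mathcal{F}$ on ground set $[n]$ with $\mathcal{S}(\mathcal{F})\neq\emptyset$ and $a(\mathcal{F})\le a$. -}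

module Defs where

open import Data.Nat using (ℕ; _≤_)
open import Data.Fin using (Fin)
open import Data.Fin.Subset using (Subset; _∪_; _∈_)
open import Data.Fin.Subset.Properties using (_∈?_)
open import Data.List using (List; []; _∷_; length; filter)
open import Data.List.Relation.Unary.Unique.Propositional using (Unique)
import Data.List.Membership.Propositional as LM
open import Data.Product using (Σ; _×_)

-- A family on ground set [n]: a finite list of subsets of Fin n, required to be
-- duplicate-free (so it represents a collection of *distinct* sets).
record Family (n : ℕ) : Set where
  field
    sets     : List (Subset n)
    distinct : Unique sets

open Family public

m : ∀ {n} → Family n → ℕ
m F = length (sets F)

mₑ : ∀ {n} → Family n → Fin n → ℕ
mₑ F e = length (filter (e ∈?_) (sets F))

UnionClosed : ∀ {n} → Family n → Set
UnionClosed F = ∀ {S T} → S LM.∈ sets F → T LM.∈ sets F → (S ∪ T) LM.∈ sets F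

NonEmpty : ∀ {n} → Family n → Set
NonEmpty F = sets F ≢ []
  where
  open import Relation.Binary.PropositionalEquality using (_≢_)

-- a(F) ≤ a  ⇔  m_e(F) ≤ a for every e ∈ [n]   (a(F) = max_e m_e(F))
aBounded : ∀ {n} → Family n → ℕ → Set
aBounded {n} F a = (e : Fin n) → mₑ F e ≤ a

Admissible : (n a : ℕ) → Family n → Set
Admissible n a F = UnionClosed F × NonEmpty F × aBounded F a

-- "f(n,a) = k": k is the maximum of m(F) over admissible F
-- (attained, and an upper bound).
IsF : (n a k : ℕ) → Set
IsF n a k = Σ (Family n) (λ F → Admissible n a F × m F ≡ k)
          × ((F : Family n) → Admissible n a F → m F ≤ k)
  where
  open import Relation.Binary.PropositionalEquality using (_≡_)

-- Adding a point that lies in no member gives f(n-1,a) ≤ f(n,a). Conversely, deleting a point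
-- preserves union-closedness and every degree, so it suffices to find, in an optimal family on
-- n points, a point whose deletion is injective on the family: one in no member, or one with a
-- twin lying in exactly the same members. If there is none, every point is covered and any two
-- points are separated by a member. Let N e = maxAvoiding e be the union of the members avoiding
-- e and pick e* with |N e*| minimal: minimality forces e* ∈ N e for every e ≠ e*, so e* lies in
-- the n distinct members ⋃F and N e (e ≠ e*), i.e. its degree is at least n > a.
module Submission where

open import Defs
open import Data.Nat using (ℕ; _≤_; _<_; _∸_; zero; suc; z≤n; _≤?_)
open import Data.Product using (Σ; _×_; _,_; proj₁; proj₂; ∃-syntax)
open import Data.Nat.Properties using (≤-trans; ≤-antisym; ≤-reflexive; ≰⇒>; <⇒≱; <-≤-trans; <-irrefl)
open import Data.Sum using (_⊎_; inj₁; inj₂; [_,_]′)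
open import Data.Bool using (true; false; _∨_) renaming (_≟_ to _≟ᵇ_)
open import Data.Fin using (Fin; punchIn; punchOut) renaming (_≟_ to _≟ᶠ_)
open import Data.Fin.Properties using (pigeonhole; <⇒≢; punchIn-injective; punchInᵢ≢i; punchOut-punchIn; all?)
  renaming (any? to anyᶠ?)
open import Data.Fin.Subset using (Subset; inside; outside; _∪_; ⊥; ⋃; _∈_; _∉_; _⊆_; ∣_∣)
open import Data.Fin.Subset.Properties using (_∈?_; drop-there; ∪-identityʳ; ∉⊥; ∪-idem; p⊆p∪q; q⊆p∪q; x∈p∪q⁻; p⊂q⇒∣p∣<∣q∣)
open import Data.Vec using (Vec; _∷_; []; lookup; removeAt; insertAt; here; there)
open import Data.Vec.Properties using (≡-dec; ∷-injectiveʳ; []=⇒lookup; lookup⇒[]=; removeAt-punchOut; insertAt-removeAt)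
open import Data.List using (List; []; _∷_; length; filter; map; _++_; tabulate; allFin)
import Data.List.Base as List
open import Data.List.Properties using (length-map; length-tabulate)
open import Data.List.Extrema.Nat using (argmin; argmax; f[argmin]≤f[xs]; f[xs]≤f[argmax]; argmax-all)
open import Data.List.Relation.Unary.All as All using (All; []; _∷_)
open import Data.List.Relation.Unary.All.Properties using (anti-mono; all-filter; ¬All⇒Any¬)
import Data.List.Relation.Unary.All.Properties as Allₚ
open import Data.List.Relation.Unary.Any as Any using (here; there)
open import Data.List.Relation.Unary.Any.Properties using (lookup-index)
open import Data.List.Relation.Unary.Unique.Propositional using (Unique)
open import Data.List.Relation.Unary.AllPairs using ([]; _∷_)
import Data.List.Relation.Unary.Unique.Propositional.Properties as Unique
open import Data.List.Membership.Propositional using (find) renaming (_∈_ to _∈ₗ_)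
open import Data.List.Membership.Propositional.Properties
  using (∈-lookup; ∈-map⁺; ∈-map⁻; ∈-++⁺ˡ; ∈-++⁺ʳ; ∈-filter⁺; ∈-filter⁻; ∈-tabulate⁻; ∈-allFin)
open import Data.List.Relation.Binary.Disjoint.Propositional using (Disjoint)
import Data.List.Membership.DecPropositional as DecMembership
open import Data.List.Relation.Binary.Subset.Propositional using () renaming (_⊆_ to _⊆ₗ_)
open import Data.List.Relation.Binary.Subset.Propositional.Properties using (filter⁺′)
open import Relation.Binary.PropositionalEquality using (_≡_; _≢_; refl; sym; trans; cong; cong₂; subst; module ≡-Reasoning)
open import Relation.Nullary using (Dec; does; yes; no; ¬_; ¬?; contradiction)
open import Relation.Nullary.Decidable using (_×-dec_; map′; decidable-stable)
open import Relation.Unary using (Pred; Decidable)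
open import Level using (0ℓ)
open import Function using (_∘_)

private
  variable
    A B : Set
    n a k k′ : ℕ

lookup-injective : {xs : List A} → Unique xs → ∀ {i j} → List.lookup xs i ≡ List.lookup xs j → i ≡ j
lookup-injective (_ ∷ _)     {Fin.zero}  {Fin.zero}  _  = refl
lookup-injective (x∉ ∷ _)    {Fin.zero}  {Fin.suc j} eq = contradiction eq (All.lookup x∉ (∈-lookup j))
lookup-injective (x∉ ∷ _)    {Fin.suc i} {Fin.zero}  eq = contradiction (sym eq) (All.lookup x∉ (∈-lookup i))
lookup-injective (_ ∷ uniq)  {Fin.suc i} {Fin.suc j} eq = cong Fin.suc (lookup-injective uniq eq)

length-mono-⊆ : {xs ys : List A} → Unique xs → xs ⊆ₗ ys → length xs ≤ length ys
length-mono-⊆ {xs = xs} {ys} uniq xs⊆ys with length xs ≤? length ys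
... | yes le = le
... | no gt with i , j , i<j , same-index ← pigeonhole (≰⇒> gt) (λ i → Any.index (xs⊆ys (∈-lookup i)))
  = contradiction (lookup-injective uniq (begin
      List.lookup xs i                                   ≡⟨ lookup-index (xs⊆ys (∈-lookup i)) ⟩
      List.lookup ys (Any.index (xs⊆ys (∈-lookup i)))    ≡⟨ cong (List.lookup ys) same-index ⟩
      List.lookup ys (Any.index (xs⊆ys (∈-lookup j)))    ≡⟨ sym (lookup-index (xs⊆ys (∈-lookup j))) ⟩
      List.lookup xs j                                   ∎))
    (<⇒≢ i<j)
  where open ≡-Reasoning

∈⇒≢[] : {x : A} {xs : List A} → x ∈ₗ xs → xs ≢ []
∈⇒≢[] (here _)  ()
∈⇒≢[] (there _) ()

≢[]-mono : {xs ys : List A} → xs ⊆ₗ ys → xs ≢ [] → ys ≢ []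
≢[]-mono {xs = []}    _     xs≢[] = contradiction refl xs≢[]
≢[]-mono {xs = _ ∷ _} xs⊆ys _     = ∈⇒≢[] (xs⊆ys (here refl))

map⁺-injectiveOn : {xs : List A} (f : A → B) →
  (∀ {x y} → x ∈ₗ xs → y ∈ₗ xs → f x ≡ f y → x ≡ y) → Unique xs → Unique (map f xs)
map⁺-injectiveOn {xs = []}     f inj []          = []
map⁺-injectiveOn {xs = x ∷ xs} f inj (x∉ ∷ uniq) =
  Allₚ.map⁺ (All.tabulate (λ y∈xs fx≡fy → All.lookup x∉ y∈xs (inj (here refl) (there y∈xs) fx≡fy)))
  ∷ map⁺-injectiveOn f (λ x∈ y∈ → inj (there x∈) (there y∈)) uniq

length-filter-map : {P : Pred B 0ℓ} {Q : Pred A 0ℓ} (P? : Decidable P) (Q? : Decidable Q) (f : A → B) →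
  (∀ {x} → P (f x) → Q x) → (∀ {x} → Q x → P (f x)) →
  ∀ xs → length (filter P? (map f xs)) ≡ length (filter Q? xs)
length-filter-map P? Q? f to from [] = refl
length-filter-map P? Q? f to from (x ∷ xs) with P? (f x) | Q? x
... | yes _  | yes _ = cong suc (length-filter-map P? Q? f to from xs)
... | no _   | no _  = length-filter-map P? Q? f to from xs
... | yes p  | no ¬q = contradiction (to p) ¬q
... | no ¬p  | yes q = contradiction (from q) ¬p

m-mono : (F G : Family n) → sets F ⊆ₗ sets G → m F ≤ m G
m-mono F G = length-mono-⊆ (distinct F)

mₑ-mono : (F G : Family n) → sets F ⊆ₗ sets G → ∀ e → mₑ F e ≤ mₑ G e
mₑ-mono F G F⊆G e =
  length-mono-⊆ (Unique.filter⁺ (e ∈?_) (distinct F)) (filter⁺′ (e ∈?_) (e ∈?_) (λ e∈ → e∈) F⊆G)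

admissible-cong : (F G : Family n) → sets F ⊆ₗ sets G → sets G ⊆ₗ sets F →
  Admissible n a F → Admissible n a G
admissible-cong F G F⊆G G⊆F (closed , nonEmpty , bounded) =
    (λ S∈ T∈ → F⊆G (closed (G⊆F S∈) (G⊆F T∈)))
  , ≢[]-mono F⊆G nonEmpty
  , (λ e → ≤-trans (mₑ-mono G F G⊆F e) (bounded e))

allSubsets : (n : ℕ) → List (Subset n)
allSubsets zero    = [] ∷ []
allSubsets (suc n) = map (inside ∷_) (allSubsets n) ++ map (outside ∷_) (allSubsets n)

∈-allSubsets : (S : Subset n) → S ∈ₗ allSubsets n
∈-allSubsets []            = here refl
∈-allSubsets (inside ∷ S)  = ∈-++⁺ˡ (∈-map⁺ (inside ∷_) (∈-allSubsets S))
∈-allSubsets (outside ∷ S) = ∈-++⁺ʳ _ (∈-map⁺ (outside ∷_) (∈-allSubsets S))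

allSubsets-unique : ∀ n → Unique (allSubsets n)
allSubsets-unique zero    = [] ∷ []
allSubsets-unique (suc n) =
  Unique.++⁺ (Unique.map⁺ ∷-injectiveʳ uniq) (Unique.map⁺ ∷-injectiveʳ uniq) disjoint
  where
  uniq = allSubsets-unique n
  disjoint : Disjoint (map (inside ∷_) (allSubsets n)) (map (outside ∷_) (allSubsets n))
  disjoint (S∈ , T∈) with ∈-map⁻ (inside ∷_) S∈ | ∈-map⁻ (outside ∷_) T∈
  ... | _ , _ , refl | _ , _ , ()

select : (xs : List A) → Subset (length xs) → List A
select []       []            = []
select (x ∷ xs) (inside ∷ c)  = x ∷ select xs c
select (x ∷ xs) (outside ∷ c) = select xs c

select-⊆ : (xs : List A) (c : Subset (length xs)) → select xs c ⊆ₗ xs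
select-⊆ []       []            ()
select-⊆ (x ∷ xs) (inside ∷ c)  (here refl) = here refl
select-⊆ (x ∷ xs) (inside ∷ c)  (there y∈)  = there (select-⊆ xs c y∈)
select-⊆ (x ∷ xs) (outside ∷ c) y∈          = there (select-⊆ xs c y∈)

select-unique : {xs : List A} (c : Subset (length xs)) → Unique xs → Unique (select xs c)
select-unique {xs = []}     []            []          = []
select-unique {xs = x ∷ xs} (inside ∷ c)  (x∉ ∷ uniq) = anti-mono (select-⊆ xs c) x∉ ∷ select-unique c uniq
select-unique {xs = x ∷ xs} (outside ∷ c) (_ ∷ uniq)  = select-unique c uniq

indicator : {P : Pred A 0ℓ} → Decidable P → (xs : List A) → Subset (length xs)
indicator P? []       = []
indicator P? (x ∷ xs) = does (P? x) ∷ indicator P? xs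

select-indicator : {P : Pred A 0ℓ} (P? : Decidable P) (xs : List A) → select xs (indicator P? xs) ≡ filter P? xs
select-indicator P? []       = refl
select-indicator P? (x ∷ xs) with does (P? x)
... | true  = cong (x ∷_) (select-indicator P? xs)
... | false = select-indicator P? xs

_∈ₗ?_ : (S : Subset n) (xs : List (Subset n)) → Dec (S ∈ₗ xs)
_∈ₗ?_ = DecMembership._∈?_ (≡-dec _≟ᵇ_)

admissible? : (F : Family n) → Dec (Admissible n a F)
admissible? {a = a} F = unionClosed? ×-dec nonEmpty? (sets F) ×-dec all? (λ e → mₑ F e ≤? a)
  where
  unionClosed? : Dec (UnionClosed F)
  unionClosed? =
    map′ (λ closed S∈ T∈ → All.lookup (All.lookup closed S∈) T∈)
         (λ closed → All.tabulate (λ S∈ → All.tabulate (λ T∈ → closed S∈ T∈)))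
         (All.all? (λ S → All.all? (λ T → (S ∪ T) ∈ₗ? sets F) (sets F)) (sets F))
  nonEmpty? : (xs : List (Subset _)) → Dec (xs ≢ [])
  nonEmpty? []      = no (λ []≢[] → []≢[] refl)
  nonEmpty? (_ ∷ _) = yes (λ ())

-- A family is determined up to order by the indicator vector of its members within allSubsets n,
-- so the admissible families can be searched exhaustively.
Code : ℕ → Set
Code n = Subset (length (allSubsets n))

familyOf : ∀ n → Code n → Family n
familyOf n c = record { sets = select (allSubsets n) c ; distinct = select-unique c (allSubsets-unique n) }

codeOf : Family n → Code n
codeOf {n} F = indicator (_∈ₗ? sets F) (allSubsets n)

familyOf-codeOf-⊆ : (F : Family n) → sets (familyOf n (codeOf F)) ⊆ₗ sets F
familyOf-codeOf-⊆ {n} F S∈ =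
  proj₂ (∈-filter⁻ (_∈ₗ? sets F) {xs = allSubsets n} (subst (_ ∈ₗ_) (select-indicator (_∈ₗ? sets F) (allSubsets n)) S∈))

familyOf-codeOf-⊇ : (F : Family n) → sets F ⊆ₗ sets (familyOf n (codeOf F))
familyOf-codeOf-⊇ {n} F {S} S∈ =
  subst (S ∈ₗ_) (sym (select-indicator (_∈ₗ? sets F) (allSubsets n))) (∈-filter⁺ (_∈ₗ? sets F) (∈-allSubsets S) S∈)

admissible-familyOf-codeOf : (F : Family n) → Admissible n a F → Admissible n a (familyOf n (codeOf F))
admissible-familyOf-codeOf {n} F = admissible-cong F (familyOf n (codeOf F)) (familyOf-codeOf-⊇ F) (familyOf-codeOf-⊆ F)

⁅⊥⁆ : Family n
⁅⊥⁆ = record { sets = ⊥ ∷ [] ; distinct = [] ∷ [] }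

⁅⊥⁆-admissible : Admissible n a ⁅⊥⁆
⁅⊥⁆-admissible {n} = closed , (λ ()) , degree-zero
  where
  closed : UnionClosed {n} ⁅⊥⁆
  closed (here refl) (here refl) = here (∪-idem ⊥)
  degree-zero : ∀ e → mₑ ⁅⊥⁆ e ≤ _
  degree-zero e with e ∈? ⊥
  ... | yes e∈⊥ = contradiction e∈⊥ ∉⊥
  ... | no _    = z≤n

f-exists : ∀ n a → Σ ℕ (IsF n a)
f-exists n a = m (familyOf n best) , (familyOf n best , best-admissible , refl) , best-maximal
  where
  candidates : List (Code n)
  candidates = filter (admissible? ∘ familyOf n) (allSubsets (length (allSubsets n)))
  best : Code n
  best = argmax (m ∘ familyOf n) (codeOf (⁅⊥⁆ {n})) candidates
  best-admissible : Admissible n a (familyOf n best)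
  best-admissible = argmax-all (m ∘ familyOf n) (admissible-familyOf-codeOf (⁅⊥⁆ {n}) ⁅⊥⁆-admissible)
                               (all-filter (admissible? ∘ familyOf n) (allSubsets (length (allSubsets n))))
  best-maximal : ∀ F → Admissible n a F → m F ≤ m (familyOf n best)
  best-maximal F admissible = ≤-trans (m-mono F (familyOf n (codeOf F)) (familyOf-codeOf-⊇ F))
    (All.lookup (f[xs]≤f[argmax] {f = m ∘ familyOf n} (codeOf (⁅⊥⁆ {n})) candidates)
                (∈-filter⁺ (admissible? ∘ familyOf n) (∈-allSubsets (codeOf F)) (admissible-familyOf-codeOf F admissible)))

map-≢[] : (f : A → B) {xs : List A} → xs ≢ [] → map f xs ≢ []
map-≢[] f {[]}    xs≢[] = contradiction refl xs≢[]
map-≢[] f {_ ∷ _} _     ()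

lift : Family n → Family (suc n)
lift F = record { sets = map (outside ∷_) (sets F) ; distinct = Unique.map⁺ ∷-injectiveʳ (distinct F) }

mₑ-lift-zero : (xs : List (Subset n)) → length (filter (Fin.zero ∈?_) (map (outside ∷_) xs)) ≡ 0
mₑ-lift-zero []       = refl
mₑ-lift-zero (_ ∷ xs) = mₑ-lift-zero xs

lift-admissible : (F : Family n) → Admissible n a F → Admissible (suc n) a (lift F)
lift-admissible F (closed , nonEmpty , bounded) = closed′ , map-≢[] (outside ∷_) nonEmpty , bounded′
  where
  closed′ : UnionClosed (lift F)
  closed′ S∈ T∈ with ∈-map⁻ (outside ∷_) S∈ | ∈-map⁻ (outside ∷_) T∈
  ... | _ , S∈F , refl | _ , T∈F , refl = ∈-map⁺ (outside ∷_) (closed S∈F T∈F)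
  bounded′ : aBounded (lift F) _
  bounded′ Fin.zero    = ≤-trans (≤-reflexive (mₑ-lift-zero (sets F))) z≤n
  bounded′ (Fin.suc e) = ≤-trans
    (≤-reflexive (length-filter-map (Fin.suc e ∈?_) (e ∈?_) (outside ∷_) drop-there (λ e∈ → there e∈) (sets F)))
    (bounded e)

f-mono : IsF n a k → IsF (suc n) a k′ → k ≤ k′
f-mono ((F , admissible , refl) , _) (_ , maximal) =
  ≤-trans (≤-reflexive (sym (length-map (outside ∷_) (sets F)))) (maximal (lift F) (lift-admissible F admissible))

lookup-removeAt : (xs : Vec A (suc n)) (i : Fin (suc n)) (j : Fin n) →
  lookup (removeAt xs i) j ≡ lookup xs (punchIn i j)
lookup-removeAt xs i j = begin
  lookup (removeAt xs i) j                                  ≡⟨ cong (lookup (removeAt xs i)) (sym (punchOut-punchIn i)) ⟩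
  lookup (removeAt xs i) (punchOut (punchInᵢ≢i i j ∘ sym))  ≡⟨ removeAt-punchOut xs (punchInᵢ≢i i j ∘ sym) ⟩
  lookup xs (punchIn i j)                                   ∎
  where open ≡-Reasoning

removeAt-injective : (xs ys : Vec A (suc n)) (i : Fin (suc n)) →
  removeAt xs i ≡ removeAt ys i → lookup xs i ≡ lookup ys i → xs ≡ ys
removeAt-injective xs ys i same-rest same-at-i = begin
  xs                                      ≡⟨ sym (insertAt-removeAt xs i) ⟩
  insertAt (removeAt xs i) i (lookup xs i) ≡⟨ cong₂ (λ zs z → insertAt zs i z) same-rest same-at-i ⟩
  insertAt (removeAt ys i) i (lookup ys i) ≡⟨ insertAt-removeAt ys i ⟩
  ys                                      ∎
  where open ≡-Reasoning

removeAt-∪ : (S T : Subset (suc n)) (i : Fin (suc n)) → removeAt (S ∪ T) i ≡ removeAt S i ∪ removeAt T i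
removeAt-∪ (_ ∷ _)         (_ ∷ _)         Fin.zero    = refl
removeAt-∪ (_ ∷ [])        (_ ∷ [])        (Fin.suc ())
removeAt-∪ (x ∷ S@(_ ∷ _)) (y ∷ T@(_ ∷ _)) (Fin.suc i) = cong ((x ∨ y) ∷_) (removeAt-∪ S T i)

∈-removeAt⁻ : {S : Subset (suc n)} {i : Fin (suc n)} {e : Fin n} → e ∈ removeAt S i → punchIn i e ∈ S
∈-removeAt⁻ {S = S} {i} {e} e∈ = lookup⇒[]= (punchIn i e) S (trans (sym (lookup-removeAt S i e)) ([]=⇒lookup e∈))

∈-removeAt⁺ : {S : Subset (suc n)} {i : Fin (suc n)} {e : Fin n} → punchIn i e ∈ S → e ∈ removeAt S i
∈-removeAt⁺ {S = S} {i} {e} e∈ = lookup⇒[]= e (removeAt S i) (trans (lookup-removeAt S i e) ([]=⇒lookup e∈))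

∉⇒lookup≡outside : {S : Subset n} {x : Fin n} → x ∉ S → lookup S x ≡ outside
∉⇒lookup≡outside {S = S} {x} x∉S with lookup S x in eq
... | inside  = contradiction (lookup⇒[]= x S eq) x∉S
... | outside = refl

lookup≡outside⇒∉ : {S : Subset n} {x : Fin n} → lookup S x ≡ outside → x ∉ S
lookup≡outside⇒∉ eq x∈S with () ← trans (sym ([]=⇒lookup x∈S)) eq

Redundant : Family (suc n) → Fin (suc n) → Set
Redundant F i = ∀ {S T} → S ∈ₗ sets F → T ∈ₗ sets F → removeAt S i ≡ removeAt T i → S ≡ T

delete : (F : Family (suc n)) (i : Fin (suc n)) → Redundant F i → Family n
delete F i redundant = record
  { sets     = map (λ S → removeAt S i) (sets F)
  ; distinct = map⁺-injectiveOn (λ S → removeAt S i) redundant (distinct F)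
  }

delete-admissible : (F : Family (suc n)) (i : Fin (suc n)) (redundant : Redundant F i) →
  Admissible (suc n) a F → Admissible n a (delete F i redundant)
delete-admissible F i redundant (closed , nonEmpty , bounded) =
  closed′ , map-≢[] (λ S → removeAt S i) nonEmpty , bounded′
  where
  closed′ : UnionClosed (delete F i redundant)
  closed′ S∈ T∈ with ∈-map⁻ (λ S → removeAt S i) S∈ | ∈-map⁻ (λ S → removeAt S i) T∈
  ... | S , S∈F , refl | T , T∈F , refl =
    subst (_∈ₗ sets (delete F i redundant)) (removeAt-∪ S T i) (∈-map⁺ (λ S → removeAt S i) (closed S∈F T∈F))
  bounded′ : aBounded (delete F i redundant) _
  bounded′ e = ≤-trans
    (≤-reflexive (length-filter-map (e ∈?_) (punchIn i e ∈?_) (λ S → removeAt S i) ∈-removeAt⁻ ∈-removeAt⁺ (sets F)))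
    (bounded (punchIn i e))

unused⇒redundant : {F : Family (suc n)} {i : Fin (suc n)} → (∀ {S} → S ∈ₗ sets F → i ∉ S) → Redundant F i
unused⇒redundant {i = i} i∉ {S} {T} S∈ T∈ same-rest =
  removeAt-injective S T i same-rest (trans (∉⇒lookup≡outside (i∉ S∈)) (sym (∉⇒lookup≡outside (i∉ T∈))))

Twins : Family n → Fin n → Fin n → Set
Twins F i j = All (λ S → lookup S i ≡ lookup S j) (sets F)

twins? : (F : Family n) (i j : Fin n) → Dec (Twins F i j)
twins? F i j = All.all? (λ S → lookup S i ≟ᵇ lookup S j) (sets F)

twin⇒redundant : {F : Family (suc n)} {i j : Fin (suc n)} → i ≢ j →
  Twins F i j → Redundant F i
twin⇒redundant {i = i} {j} i≢j twins {S} {T} S∈ T∈ same-rest = removeAt-injective S T i same-rest (begin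
  lookup S i                            ≡⟨ All.lookup twins S∈ ⟩
  lookup S j                            ≡⟨ sym (removeAt-punchOut S i≢j) ⟩
  lookup (removeAt S i) (punchOut i≢j)  ≡⟨ cong (λ U → lookup U (punchOut i≢j)) same-rest ⟩
  lookup (removeAt T i) (punchOut i≢j)  ≡⟨ removeAt-punchOut T i≢j ⟩
  lookup T j                            ≡⟨ sym (All.lookup twins T∈) ⟩
  lookup T i                            ∎)
  where open ≡-Reasoning

⊆⋃ : {S : Subset n} {xs : List (Subset n)} → S ∈ₗ xs → S ⊆ ⋃ xs
⊆⋃ {xs = T ∷ xs} (here refl) = p⊆p∪q (⋃ xs)
⊆⋃ {xs = T ∷ xs} (there S∈)  = λ x∈S → q⊆p∪q T (⋃ xs) (⊆⋃ S∈ x∈S)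

∈⋃⁻ : {x : Fin n} {xs : List (Subset n)} → x ∈ ⋃ xs → ∃[ S ] S ∈ₗ xs × x ∈ S
∈⋃⁻ {xs = []}     x∈ = contradiction x∈ ∉⊥
∈⋃⁻ {xs = S ∷ xs} x∈ with x∈p∪q⁻ S (⋃ xs) x∈
... | inj₁ x∈S  = S , here refl , x∈S
... | inj₂ x∈⋃ with T , T∈ , x∈T ← ∈⋃⁻ x∈⋃ = T , there T∈ , x∈T

⋃-closed : (F : Family n) → UnionClosed F → {xs : List (Subset n)} → xs ⊆ₗ sets F → xs ≢ [] → ⋃ xs ∈ₗ sets F
⋃-closed F closed {[]}         _   xs≢[] = contradiction refl xs≢[]
⋃-closed F closed {S ∷ []}     xs⊆ _     = subst (_∈ₗ sets F) (sym (∪-identityʳ S)) (xs⊆ (here refl))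
⋃-closed F closed {S ∷ T ∷ xs} xs⊆ _     = closed (xs⊆ (here refl)) (⋃-closed F closed (xs⊆ ∘ there) (λ ()))

Covers : Family n → Set
Covers F = ∀ x → x ∈ ⋃ (sets F)

Separates : Family n → Fin n → Fin n → Set
Separates F i j = ∃[ S ] S ∈ₗ sets F × i ∈ S × j ∉ S

SeparatesPoints : Family n → Set
SeparatesPoints F = ∀ i j → i ≢ j → Separates F i j ⊎ Separates F j i

lookup≢⇒separates : {F : Family n} {S : Subset n} {i j : Fin n} → S ∈ₗ sets F →
  lookup S i ≢ lookup S j → Separates F i j ⊎ Separates F j i
lookup≢⇒separates {S = S} {i} {j} S∈ differ with lookup S i in eqᵢ | lookup S j in eqⱼ
... | inside  | outside = inj₁ (S , S∈ , lookup⇒[]= i S eqᵢ , lookup≡outside⇒∉ eqⱼ)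
... | outside | inside  = inj₂ (S , S∈ , lookup⇒[]= j S eqⱼ , lookup≡outside⇒∉ eqᵢ)
... | inside  | inside  = contradiction refl differ
... | outside | outside = contradiction refl differ

redundant-or-separating : (F : Family (suc n)) → (∃[ i ] Redundant F i) ⊎ (Covers F × SeparatesPoints F)
redundant-or-separating F with anyᶠ? (λ i → ¬? (i ∈? ⋃ (sets F)))
... | yes (i , i∉⋃) = inj₁ (i , unused⇒redundant {F = F} (λ S∈ i∈S → i∉⋃ (⊆⋃ S∈ i∈S)))
... | no noneUnused with anyᶠ? (λ i → anyᶠ? (λ j → ¬? (i ≟ᶠ j) ×-dec twins? F i j))
...   | yes (i , j , i≢j , twins) = inj₁ (i , twin⇒redundant {F = F} i≢j twins)
...   | no noTwins = inj₂ (covers , separates)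
  where
  covers : Covers F
  covers x = decidable-stable (x ∈? ⋃ (sets F)) (λ x∉ → noneUnused (x , x∉))
  separates : SeparatesPoints F
  separates i j i≢j with _ , S∈ , differ ← find (¬All⇒Any¬ (λ S → lookup S i ≟ᵇ lookup S j) (sets F)
                                                 (λ twins → noTwins (i , j , i≢j , twins)))
    = lookup≢⇒separates {F = F} S∈ differ

module _ (F : Family n) where

  avoiding : Fin n → List (Subset n)
  avoiding e = filter (λ S → ¬? (e ∈? S)) (sets F)

  maxAvoiding : Fin n → Subset n
  maxAvoiding e = ⋃ (avoiding e)

  ⊆maxAvoiding : {S : Subset n} {e : Fin n} → S ∈ₗ sets F → e ∉ S → S ⊆ maxAvoiding e
  ⊆maxAvoiding {e = e} S∈ e∉S = ⊆⋃ (∈-filter⁺ (λ S → ¬? (e ∈? S)) S∈ e∉S)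

  ∈avoiding⁻ : {S : Subset n} {e : Fin n} → S ∈ₗ avoiding e → S ∈ₗ sets F × e ∉ S
  ∈avoiding⁻ {e = e} = ∈-filter⁻ (λ S → ¬? (e ∈? S)) {xs = sets F}

  ∉maxAvoiding : (e : Fin n) → e ∉ maxAvoiding e
  ∉maxAvoiding e e∈ with S , S∈ , e∈S ← ∈⋃⁻ e∈ = proj₂ (∈avoiding⁻ S∈) e∈S

  maxAvoiding-mono : {e e′ : Fin n} → e ∉ maxAvoiding e′ → maxAvoiding e′ ⊆ maxAvoiding e
  maxAvoiding-mono e∉ x∈ with S , S∈ , x∈S ← ∈⋃⁻ x∈ =
    ⊆maxAvoiding (proj₁ (∈avoiding⁻ S∈)) (λ e∈S → e∉ (⊆⋃ S∈ e∈S)) x∈S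

  maxAvoiding-∈ : UnionClosed F → {x e : Fin n} → x ∈ maxAvoiding e → maxAvoiding e ∈ₗ sets F
  maxAvoiding-∈ closed x∈ =
    ⋃-closed F closed (proj₁ ∘ ∈avoiding⁻) (∈⇒≢[] (proj₁ (proj₂ (∈⋃⁻ x∈))))

  separates⇒∈maxAvoiding : {i j : Fin n} → Separates F i j → i ∈ maxAvoiding j
  separates⇒∈maxAvoiding (S , S∈ , i∈S , j∉S) = ⊆maxAvoiding S∈ j∉S i∈S

  separatesPoints⇒∈maxAvoiding : SeparatesPoints F → {i j : Fin n} → i ≢ j → i ∈ maxAvoiding j ⊎ j ∈ maxAvoiding i
  separatesPoints⇒∈maxAvoiding separates {i} {j} i≢j with separates i j i≢j
  ... | inj₁ i|j = inj₁ (separates⇒∈maxAvoiding i|j)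
  ... | inj₂ j|i = inj₂ (separates⇒∈maxAvoiding j|i)

  maxAvoiding-injective : SeparatesPoints F → {i j : Fin n} → maxAvoiding i ≡ maxAvoiding j → i ≡ j
  maxAvoiding-injective separates {i} {j} Ni≡Nj =
    decidable-stable (i ≟ᶠ j) (λ i≢j → [ i∉Ni , j∉Nj ]′ (separatesPoints⇒∈maxAvoiding separates i≢j))
    where
    i∉Ni : i ∉ maxAvoiding j
    i∉Ni i∈Nj = ∉maxAvoiding i (subst (i ∈_) (sym Ni≡Nj) i∈Nj)
    j∉Nj : j ∉ maxAvoiding i
    j∉Nj j∈Ni = ∉maxAvoiding j (subst (j ∈_) Ni≡Nj j∈Ni)

  -- If e* ∉ maxAvoiding e, then maxAvoiding e ⊂ maxAvoiding e* (witnessed by e), against minimality.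
  minimal⇒∈maxAvoiding : SeparatesPoints F → (e* : Fin n) → (∀ e → ∣ maxAvoiding e* ∣ ≤ ∣ maxAvoiding e ∣) →
    ∀ e → e ≢ e* → e* ∈ maxAvoiding e
  minimal⇒∈maxAvoiding separates e* minimal e e≢e* with separatesPoints⇒∈maxAvoiding separates (e≢e* ∘ sym)
  ... | inj₁ e*∈Ne = e*∈Ne
  ... | inj₂ e∈Ne* = decidable-stable (e* ∈? maxAvoiding e) λ e*∉Ne →
    <-irrefl refl (<-≤-trans (p⊂q⇒∣p∣<∣q∣ (maxAvoiding-mono e*∉Ne , e , e∈Ne* , ∉maxAvoiding e)) (minimal e))

degree-lower-bound : (F : Family (suc n)) → UnionClosed F → Covers F → SeparatesPoints F →
  (e* : Fin (suc n)) → (∀ e → e ≢ e* → e* ∈ maxAvoiding F e) → suc n ≤ mₑ F e*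
degree-lower-bound {n} F closed covers separates e* e*∈N =
  ≤-trans (≤-reflexive (sym (cong suc (length-tabulate (N ∘ punchIn e*)))))
          (length-mono-⊆ witnesses-unique witnesses-contain-e*)
  where
  N : Fin (suc n) → Subset (suc n)
  N = maxAvoiding F

  witnesses : List (Subset (suc n))
  witnesses = ⋃ (sets F) ∷ tabulate (N ∘ punchIn e*)

  witnesses-unique : Unique witnesses
  witnesses-unique =
      Allₚ.tabulate⁺ (λ k U≡N → ∉maxAvoiding F (punchIn e* k) (subst (punchIn e* k ∈_) U≡N (covers (punchIn e* k))))
    ∷ Unique.tabulate⁺ (λ eq → punchIn-injective e* _ _ (maxAvoiding-injective F separates eq))

  witnesses-contain-e* : witnesses ⊆ₗ filter (e* ∈?_) (sets F)
  witnesses-contain-e* (here refl) =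
    ∈-filter⁺ (e* ∈?_) (⋃-closed F closed (λ S∈ → S∈) (∈⇒≢[] (proj₁ (proj₂ (∈⋃⁻ (covers e*)))))) (covers e*)
  witnesses-contain-e* (there S∈) with k , refl ← ∈-tabulate⁻ S∈ =
    ∈-filter⁺ (e* ∈?_) (maxAvoiding-∈ F closed e*∈Nk) e*∈Nk
    where
    e*∈Nk : e* ∈ N (punchIn e* k)
    e*∈Nk = e*∈N (punchIn e* k) (punchInᵢ≢i e* k)

high-degree-point : (F : Family (suc n)) → UnionClosed F → Covers F → SeparatesPoints F →
  ∃[ e ] suc n ≤ mₑ F e
high-degree-point {n} F closed covers separates =
  e* , degree-lower-bound F closed covers separates e* (minimal⇒∈maxAvoiding F separates e* minimal)
  where
  e* : Fin (suc n)
  e* = argmin (∣_∣ ∘ maxAvoiding F) Fin.zero (allFin (suc n))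
  minimal : ∀ e → ∣ maxAvoiding F e* ∣ ≤ ∣ maxAvoiding F e ∣
  minimal e = All.lookup (f[argmin]≤f[xs] {f = ∣_∣ ∘ maxAvoiding F} Fin.zero (allFin (suc n))) (∈-allFin e)

redundant-coordinate : (F : Family (suc n)) → Admissible (suc n) a F → a < suc n → ∃[ i ] Redundant F i
redundant-coordinate {n} {a} F (closed , _ , bounded) a<n+1 with redundant-or-separating F
... | inj₁ redundant              = redundant
... | inj₂ (covers , separates) = contradiction (high-degree-point F closed covers separates) too-high
  where
  too-high : ¬ (∃[ e ] suc n ≤ mₑ F e)
  too-high (e , n+1≤mₑ) = <⇒≱ a<n+1 (≤-trans n+1≤mₑ (bounded e))

f-suc≤f : a < suc n → IsF (suc n) a k′ → IsF n a k → k′ ≤ k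
f-suc≤f a<n+1 ((F , admissible , refl) , _) (_ , maximal)
  with i , redundant ← redundant-coordinate F admissible a<n+1 =
  ≤-trans (≤-reflexive (sym (length-map (λ S → removeAt S i) (sets F))))
          (maximal (delete F i redundant) (delete-admissible F i redundant admissible))

theorem3p3 : (n a : ℕ) → 1 ≤ a → a < n →
    Σ ℕ (λ k → IsF (n ∸ 1) a k × IsF n a k)
theorem3p3 zero    a _ ()
theorem3p3 (suc n) a _ a<n+1 with k , fk ← f-exists n a | k′ , fk′ ← f-exists (suc n) a =
  k , fk , subst (IsF (suc n) a) (≤-antisym (f-suc≤f a<n+1 fk′ fk) (f-mono fk fk′)) fk′
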